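{- Let $G=(V,E)$ be a connected finite simple graph with $n=|V|$, and let $\mathcal G$ be the graph constructed from $G$ as described in the context. Let $\mathcal S$ be a stalled subset of the vertex set of $\mathcal G$ with $|\mathcal S|\geqslant (2n+1)|E|+2$. Then $\mathcal S$ contains $e^0,e^1,\dots,e^{2n}$ for every $e\in E$.
   Context: For a finite simple graph $H$ with vertex set $W$ and a set $F\subseteq W$: a vertex $v\in W\setminus F$ is forced by $F$ if there is $u\in F$ such that $v$ is the unique neighbor of $u$ outside $F$. $F$ is stalled if no vertex of $W\setminus F$ is forced by $F$. Construction of $\mathcal G$: given $G=(V,E)$ with $n=|V|$, let $E^i=\{e^i : e\in E\}$ for $i=0,1,\dots,2n$ be $2n+1$ pairwise disjoint copies of $E$ (disjoint from $V$), and let $\varepsilon$ be a further new vertex. The vertex set of $\mathcal G$ is $\mathcal V=V\cup E^0\cup\dots\cup E^{2n}\cup\{\varepsilon\}$ (so $|\mathcal V|=(2n+1)|E|+n+1$). The edges of $\mathcal G$ are exactly: for every edge $e=\{u,v\}\in E$, the edges $\{u,e^0\}$ and $\{e^0,v\}$; the edges $\{e^i,e^{i+1}\}$ for $0\le i\le 2n-1$; and the edge $\{\varepsilon,e^0\}$. -}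

module Defs where

open import Data.Nat using (ℕ; zero; suc; _+_; _*_; _≥_)
open import Data.Fin using (Fin; toℕ)
open import Data.Fin.Properties using (_≟_)
open import Data.Bool using (Bool; true; false)
open import Data.List using (List; []; _∷_; _++_; map; concatMap; length; filter; allFin)
open import Data.Product using (_×_; _,_; proj₁; proj₂; Σ; ∃; ∃-syntax)
open import Data.Sum using (_⊎_)
open import Relation.Binary.PropositionalEquality using (_≡_)
open import Relation.Nullary using (¬_)
open import Relation.Nullary.Decidable using (does)

-- A finite simple graph G = (V , E) with V = Fin n and edge set E indexed by
-- Fin m : edge k has endpoints  ends k = (a , b)  with a ≠ b, and distinct
-- indices give distinct unordered pairs (so E is a set of 2-subsets of V).
record SimpleGraph (n : ℕ) : Set where
  field
    m        : ℕ
    ends     : Fin m → Fin n × Fin n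
    loopless : ∀ k → ¬ (proj₁ (ends k) ≡ proj₂ (ends k))
    distinct : ∀ k l →
               ((proj₁ (ends k) ≡ proj₁ (ends l)) × (proj₂ (ends k) ≡ proj₂ (ends l)))
               ⊎ ((proj₁ (ends k) ≡ proj₂ (ends l)) × (proj₂ (ends k) ≡ proj₁ (ends l)))
               → k ≡ l

module _ {n : ℕ} (G : SimpleGraph n) where
  open SimpleGraph G

  AdjG : Fin n → Fin n → Set
  AdjG x y = ∃[ k ] ((proj₁ (ends k) ≡ x × proj₂ (ends k) ≡ y)
                     ⊎ (proj₁ (ends k) ≡ y × proj₂ (ends k) ≡ x))

  data Walk : Fin n → Fin n → Set where
    here : ∀ x → Walk x x
    step : ∀ {x y z} → AdjG x y → Walk y z → Walk x z

  Connected : Set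
  Connected = ∀ x y → Walk x y

  -- vertices of the constructed graph 𝒢 :
  --   vtx x   (x ∈ V),  cp k i = e_k^i  (0 ≤ i ≤ 2n),  eps = ε
  data Vert : Set where
    vtx : Fin n → Vert
    cp  : Fin m → Fin (suc (2 * n)) → Vert
    eps : Vert

  IsEndpoint : Fin n → Fin m → Set
  IsEndpoint x k = (x ≡ proj₁ (ends k)) ⊎ (x ≡ proj₂ (ends k))

  data Arc : Vert → Vert → Set where
    v-e0   : ∀ {x k} {i : Fin (suc (2 * n))} → toℕ i ≡ 0 → IsEndpoint x k → Arc (vtx x) (cp k i)
    ei-ei1 : ∀ {k} {i j : Fin (suc (2 * n))} → toℕ j ≡ suc (toℕ i) → Arc (cp k i) (cp k j)
    eps-e0 : ∀ {k} {i : Fin (suc (2 * n))} → toℕ i ≡ 0 → Arc eps (cp k i)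

  Adj𝒢 : Vert → Vert → Set
  Adj𝒢 a b = Arc a b ⊎ Arc b a

  _∈S_ : Vert → (Vert → Bool) → Set
  a ∈S S = S a ≡ true

  Forced : (Vert → Bool) → Vert → Set
  Forced F v = ¬ (v ∈S F) ×
    ∃[ u ] (u ∈S F × Adj𝒢 u v × (∀ w → Adj𝒢 u w → ¬ (w ∈S F) → w ≡ v))

  Stalled : (Vert → Bool) → Set
  Stalled F = ∀ v → ¬ Forced F v

  -- explicit enumeration of the vertex set of 𝒢 (each vertex exactly once)
  allVert : List Vert
  allVert = map vtx (allFin n)
            ++ concatMap (λ k → map (cp k) (allFin (suc (2 * n)))) (allFin m)
            ++ (eps ∷ [])

  card : (Vert → Bool) → ℕ
  card S = length (filter (λ a → Data.Bool._≟_ (S a) true) allVert)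

-- Suppose e^i ∉ 𝒮 for some edge e.  An interior vertex e^j (1 ≤ j ≤ 2n) of the path
-- e^0 — e^1 — ⋯ — e^{2n} has exactly the neighbours e^{j-1} and e^{j+1}, so if e^j ∈ 𝒮
-- then, 𝒮 being stalled, either both or neither of them lie in 𝒮 (a missing e^{2n+1}
-- counting as a member).  Two consecutive members of 𝒮 on the path would therefore
-- spread to the whole path, so no two consecutive e^j lie in 𝒮 and at most n of them do.
-- Bounding V, the other paths and ε by their sizes then gives
-- |𝒮| ≤ n + ((2n+1)(|E| - 1) + n) + 1 < (2n+1)|E| + 2.
module Submission where

open import Defs
open import Data.Nat using (ℕ; zero; suc; _+_; _*_; _≤_; _<_; _≥_; z≤n; s≤s; s≤s⁻¹; _<?_; ⌈_/2⌉)
open import Data.Nat.Properties hiding (_≟_)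
open import Algebra.Properties.CommutativeSemigroup +-commutativeSemigroup using (x∙yz≈y∙xz)
open import Data.Fin as Fin using (Fin; toℕ; fromℕ<)
open import Data.Fin.Properties using (toℕ<n; fromℕ<-toℕ; toℕ-fromℕ<; toℕ-injective)
open import Data.Bool using (Bool; true; false; _≟_)
open import Data.Bool.Properties using (not-¬)
open import Data.List using (List; []; _∷_; _++_; map; concatMap; length; filter; tabulate; applyUpTo; allFin)
open import Data.List.Properties using (length-++; length-map; filter-++; length-filter; length-tabulate; map-tabulate)
open import Data.List.Membership.Propositional using (_∈_)
open import Data.List.Membership.Propositional.Properties using (∈-allFin)
open import Data.List.Relation.Unary.Any using (here; there)
open import Data.Product using (_×_; _,_; proj₁; ∃-syntax; map₂)
open import Data.Sum using (_⊎_; inj₁; inj₂; [_,_]; swap)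
open import Data.Empty using (⊥; ⊥-elim)
open import Function using (id; _∘_; flip)
open import Relation.Nullary using (¬_; yes; no; contradiction)
open import Relation.Binary.PropositionalEquality hiding ([_])

#true : {A : Set} → (A → Bool) → List A → ℕ
#true p xs = length (filter (λ a → p a ≟ true) xs)

#true-++ : ∀ {A : Set} (p : A → Bool) xs ys → #true p (xs ++ ys) ≡ #true p xs + #true p ys
#true-++ p xs ys = trans (cong length (filter-++ _ xs ys)) (length-++ (filter _ xs))

#true-≤-length : ∀ {A : Set} (p : A → Bool) xs → #true p xs ≤ length xs
#true-≤-length p = length-filter _

#true-tabulate : ∀ {A : Set} {N} (g : Fin N → A) (p : A → Bool) (f : ℕ → Bool) →
                 (∀ i → p (g i) ≡ f (toℕ i)) → #true p (tabulate g) ≡ #true id (applyUpTo f N)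
#true-tabulate {N = zero}  g p f pg≡f = refl
#true-tabulate {N = suc N} g p f pg≡f
  with p (g Fin.zero) | f 0 | pg≡f Fin.zero | #true-tabulate (g ∘ Fin.suc) p (f ∘ suc) (pg≡f ∘ Fin.suc)
... | true  | .true  | refl | ih = cong suc ih
... | false | .false | refl | ih = ih

#true-concatMap-≤ : ∀ {A X : Set} (p : A → Bool) (P : X → List A) {c} →
                    (∀ x → #true p (P x) ≤ c) → ∀ xs → #true p (concatMap P xs) ≤ c * length xs
#true-concatMap-≤ p P P≤c [] = z≤n
#true-concatMap-≤ p P {c} P≤c (x ∷ xs) = begin
  #true p (P x ++ concatMap P xs)          ≡⟨ #true-++ p (P x) (concatMap P xs) ⟩
  #true p (P x) + #true p (concatMap P xs) ≤⟨ +-mono-≤ (P≤c x) (#true-concatMap-≤ p P P≤c xs) ⟩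
  c + c * length xs                        ≡⟨ *-suc c (length xs) ⟨
  c * length (x ∷ xs)                      ∎
  where open ≤-Reasoning

#true-concatMap-≤-slack : ∀ {A X : Set} (p : A → Bool) (P : X → List A) {c e k} {xs : List X} →
                          (∀ x → #true p (P x) ≤ c) → e + #true p (P k) ≤ c → k ∈ xs →
                          e + #true p (concatMap P xs) ≤ c * length xs
#true-concatMap-≤-slack p P {c} {e} {xs = x ∷ xs} P≤c Pk≤c-e k∈xs = begin
  e + #true p (P x ++ concatMap P xs)          ≡⟨ cong (e +_) (#true-++ p (P x) (concatMap P xs)) ⟩
  e + (#true p (P x) + #true p (concatMap P xs)) ≤⟨ split k∈xs ⟩
  c + c * length xs                            ≡⟨ *-suc c (length xs) ⟨
  c * length (x ∷ xs)                          ∎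
  where
  open ≤-Reasoning
  split : _ ∈ x ∷ xs → e + (#true p (P x) + #true p (concatMap P xs)) ≤ c + c * length xs
  split (here refl) = begin
    e + (#true p (P x) + #true p (concatMap P xs)) ≡⟨ +-assoc e _ _ ⟨
    e + #true p (P x) + #true p (concatMap P xs)   ≤⟨ +-mono-≤ Pk≤c-e (#true-concatMap-≤ p P P≤c xs) ⟩
    c + c * length xs                              ∎
  split (there k∈xs) = begin
    e + (#true p (P x) + #true p (concatMap P xs)) ≡⟨ x∙yz≈y∙xz e (#true p (P x)) _ ⟩
    #true p (P x) + (e + #true p (concatMap P xs)) ≤⟨ +-mono-≤ (P≤c x) (#true-concatMap-≤-slack p P P≤c Pk≤c-e k∈xs) ⟩
    c + c * length xs                              ∎

ascend : ∀ {Q : ℕ → Set} {M} → (∀ {j} → j < M → Q j → Q (suc j)) → ∀ {j} → j ≤ M → Q j → Q M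
ascend {M = zero}  next z≤n qj = qj
ascend {M = suc M} next j≤M qj with m≤n⇒m<n∨m≡n j≤M
... | inj₂ refl = qj
... | inj₁ j<M  = next ≤-refl (ascend (next ∘ m<n⇒m<1+n) (s≤s⁻¹ j<M) qj)

descend : ∀ {Q : ℕ → Set} {M} → (∀ {j} → j < M → Q (suc j) → Q j) → Q M → ∀ {i} → i ≤ M → Q i
descend {M = zero}  next qM z≤n = qM
descend {M = suc M} next qM i≤M with m≤n⇒m<n∨m≡n i≤M
... | inj₂ refl = qM
... | inj₁ i<M  = descend (next ∘ m<n⇒m<1+n) (next ≤-refl qM) (s≤s⁻¹ i<M)

Pair : (ℕ → Bool) → ℕ → Set
Pair f j = f j ≡ true × f (suc j) ≡ true

-- f is the indicator of a stalled set on the path 0 — 1 — ⋯ — M+1, read at the interior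
-- vertices: a member never has exactly one neighbour outside the set.
PathStalled : (ℕ → Bool) → ℕ → Set
PathStalled f M = ∀ j → suc j ≤ M → f (suc j) ≡ true → f j ≡ f (suc (suc j))

pathStalled-no-pair : ∀ {f M} → PathStalled f M → ∀ {i} → i ≤ M → f i ≡ false →
                      ∀ {j} → j ≤ M → ¬ Pair f j
pathStalled-no-pair {f} {M} stalled i≤M fi≡false j≤M pair =
  not-¬ fi≡false (proj₁ (descend pair-down (ascend pair-up j≤M pair) i≤M))
  where
  pair-up : ∀ {j} → j < M → Pair f j → Pair f (suc j)
  pair-up j<M (fj , fj+1) = fj+1 , trans (sym (stalled _ j<M fj+1)) fj
  pair-down : ∀ {j} → j < M → Pair f (suc j) → Pair f j
  pair-down j<M (fj+1 , fj+2) = trans (stalled _ j<M fj+1) fj+2 , fj+1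

#true-prefix-≤ : ∀ (f : ℕ → Bool) L → ¬ Pair f 0 →
                 #true id (applyUpTo f (2 + L)) ≤ 1 + #true id (applyUpTo (λ j → f (2 + j)) L)
#true-prefix-≤ f L no-pair with f 0 | f 1
... | true  | true  = contradiction (refl , refl) no-pair
... | true  | false = ≤-refl
... | false | true  = ≤-refl
... | false | false = n≤1+n _

no-pair-#true : ∀ L (f : ℕ → Bool) → (∀ {j} → j ≤ L → ¬ Pair f j) → f (suc L) ≡ true →
                #true id (applyUpTo f (suc L)) ≤ ⌈ L /2⌉
no-pair-#true zero f no-pair f1 with f 0 in f0
... | true  = contradiction (f0 , f1) (no-pair z≤n)
... | false = z≤n
no-pair-#true (suc zero) f no-pair f2 = #true-prefix-≤ f 0 (no-pair z≤n)
no-pair-#true (suc (suc L)) f no-pair fL+3 =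
  ≤-trans (#true-prefix-≤ f (suc L) (no-pair z≤n))
          (s≤s (no-pair-#true L (λ j → f (2 + j)) (no-pair ∘ s≤s ∘ s≤s) fL+3))

⌈2*n/2⌉≡n : ∀ n → ⌈ 2 * n /2⌉ ≡ n
⌈2*n/2⌉≡n n = trans (cong (λ x → ⌈ n + x /2⌉) (+-identityʳ n)) (sym (n≡⌈n+n/2⌉ n))

module _ {n : ℕ} (G : SimpleGraph n) (S : Vert G → Bool) (stalled : Stalled G S) where
  open SimpleGraph G using (m)

  N : ℕ
  N = suc (2 * n)

  no-sole-outside-neighbour : ∀ {u v} → S u ≡ true → Adj𝒢 G u v → S v ≡ false →
                              (∀ {w} → Adj𝒢 G u w → w ≡ v ⊎ S w ≡ true) → ⊥
  no-sole-outside-neighbour u∈S uv v∉S others =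
    stalled _ (not-¬ v∉S , _ , u∈S , uv , λ w uw w∉S → [ id , flip contradiction w∉S ] (others uw))

  interior-neighbour : ∀ {k i j w} → toℕ i ≡ suc j → Adj𝒢 G (cp k i) w →
                       ∃[ i′ ] (w ≡ cp k i′ × (toℕ i′ ≡ j ⊎ toℕ i′ ≡ suc (suc j)))
  interior-neighbour i≡ (inj₁ (ei-ei1 i′≡)) = _ , refl , inj₂ (trans i′≡ (cong suc i≡))
  interior-neighbour i≡ (inj₂ (ei-ei1 i≡′)) = _ , refl , inj₁ (suc-injective (trans (sym i≡′) i≡))
  interior-neighbour i≡ (inj₂ (v-e0 i≡0 _)) = contradiction (trans (sym i≡) i≡0) 1+n≢0
  interior-neighbour i≡ (inj₂ (eps-e0 i≡0)) = contradiction (trans (sym i≡) i≡0) 1+n≢0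

  module EdgePath (k : Fin m) where

    flags : ℕ → Bool
    flags j with j <? N
    ... | yes j<N = S (cp k (fromℕ< j<N))
    ... | no  _   = true

    flags-toℕ : ∀ i → flags (toℕ i) ≡ S (cp k i)
    flags-toℕ i with toℕ i <? N
    ... | yes i<N = cong (S ∘ cp k) (fromℕ<-toℕ i i<N)
    ... | no  i≮N = contradiction (toℕ<n i) i≮N

    flags-beyond : ∀ {j} → N ≤ j → flags j ≡ true
    flags-beyond {j} N≤j with j <? N
    ... | yes j<N = contradiction j<N (≤⇒≯ N≤j)
    ... | no  _   = refl

    flags-false : ∀ {j} → flags j ≡ false → ∃[ i ] (toℕ i ≡ j × S (cp k i) ≡ false)
    flags-false {j} fj with j <? N
    flags-false {j} fj  | yes j<N = fromℕ< j<N , toℕ-fromℕ< j<N , fj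
    flags-false     ()  | no  _

    path-no-sole-outside-neighbour : ∀ {i p q} → S (cp k i) ≡ true →
      (∀ {w} → Adj𝒢 G (cp k i) w → ∃[ i′ ] (w ≡ cp k i′ × (toℕ i′ ≡ p ⊎ toℕ i′ ≡ q))) →
      (∀ {i′} → toℕ i′ ≡ q → Adj𝒢 G (cp k i) (cp k i′)) →
      flags p ≡ true → flags q ≡ false → ⊥
    path-no-sole-outside-neighbour {i} u∈S neighbours adjacent fp fq with flags-false fq
    ... | i″ , i″≡q , v∉S = no-sole-outside-neighbour u∈S (adjacent i″≡q) v∉S others
      where
      others : ∀ {w} → Adj𝒢 G (cp k i) w → w ≡ cp k i″ ⊎ S w ≡ true
      others uw with neighbours uw
      ... | i′ , refl , inj₁ i′≡p = inj₂ (trans (sym (flags-toℕ i′)) (trans (cong flags i′≡p) fp))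
      ... | i′ , refl , inj₂ i′≡q = inj₁ (cong (cp k) (toℕ-injective (trans i′≡q (sym i″≡q))))

    flags-pathStalled : PathStalled flags (2 * n)
    flags-pathStalled j j<2n fj+1 = balanced (flags j) (flags (2 + j)) refl refl
      where
      i : Fin N
      i = fromℕ< (s≤s j<2n)
      i≡ : toℕ i ≡ suc j
      i≡ = toℕ-fromℕ< (s≤s j<2n)
      u∈S : S (cp k i) ≡ true
      u∈S = trans (sym (flags-toℕ i)) (trans (cong flags i≡) fj+1)
      balanced : ∀ a b → flags j ≡ a → flags (2 + j) ≡ b → a ≡ b
      balanced true  true  _  _  = refl
      balanced false false _  _  = refl
      balanced true  false fj fj+2 =
        ⊥-elim (path-no-sole-outside-neighbour u∈S (interior-neighbour i≡)
                  (λ i′≡ → inj₁ (ei-ei1 (trans i′≡ (cong suc (sym i≡))))) fj fj+2)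
      balanced false true  fj fj+2 =
        ⊥-elim (path-no-sole-outside-neighbour u∈S (map₂ (map₂ swap) ∘ interior-neighbour i≡)
                  (λ i′≡ → inj₂ (ei-ei1 (trans i≡ (cong suc (sym i′≡))))) fj+2 fj)

    path : List (Vert G)
    path = map (cp k) (allFin N)

    length-path : length path ≡ N
    length-path = trans (length-map (cp {G = G} k) (allFin N)) (length-tabulate {n = N} id)

    path-#true-≤ : ∀ {i} → S (cp k i) ≡ false → #true S path ≤ n
    path-#true-≤ {i} i∉S = begin
      #true S path                 ≡⟨ cong (#true S) (map-tabulate id (cp k)) ⟩
      #true S (tabulate (cp k))    ≡⟨ #true-tabulate (cp k) S flags (sym ∘ flags-toℕ) ⟩
      #true id (applyUpTo flags N) ≤⟨ no-pair-#true (2 * n) flags no-pair (flags-beyond ≤-refl) ⟩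
      ⌈ 2 * n /2⌉                  ≡⟨ ⌈2*n/2⌉≡n n ⟩
      n                            ∎
      where
      open ≤-Reasoning
      no-pair : ∀ {j} → j ≤ 2 * n → ¬ Pair flags j
      no-pair = pathStalled-no-pair flags-pathStalled (s≤s⁻¹ (toℕ<n i)) (trans (flags-toℕ i) i∉S)

  open EdgePath using (path; length-path; path-#true-≤)

  card-< : ∀ {k i} → S (cp k i) ≡ false → card G S < N * m + 2
  card-< {k} i∉S = begin-strict
    card G S                              ≡⟨ #true-++ S V (E ++ eps ∷ []) ⟩
    #true S V + #true S (E ++ eps ∷ [])   ≡⟨ cong (#true S V +_) (#true-++ S E (eps ∷ [])) ⟩
    #true S V + (#true S E + #true S (eps ∷ []))
      ≤⟨ +-mono-≤ V≤n (+-monoʳ-≤ (#true S E) (#true-≤-length S (eps ∷ []))) ⟩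
    n + (#true S E + 1)                   ≡⟨ +-assoc n (#true S E) 1 ⟨
    n + #true S E + 1                     ≤⟨ +-monoˡ-≤ 1 E≤ ⟩
    N * m + 1                             <⟨ +-monoʳ-< (N * m) ≤-refl ⟩
    N * m + 2                             ∎
    where
    open ≤-Reasoning
    V = map vtx (allFin n)
    E = concatMap path (allFin m)
    V≤n : #true S V ≤ n
    V≤n = ≤-trans (#true-≤-length S V)
            (≤-reflexive (trans (length-map (vtx {G = G}) (allFin n)) (length-tabulate {n = n} id)))
    E≤ : n + #true S E ≤ N * m
    E≤ = subst (λ l → n + #true S E ≤ N * l) (length-tabulate {n = m} id)
      (#true-concatMap-≤-slack S path
        (λ x → ≤-trans (#true-≤-length S (path x)) (≤-reflexive (length-path x)))
        (m≤n⇒m≤1+n (+-monoʳ-≤ n (≤-trans (path-#true-≤ k i∉S) (m≤m+n n 0))))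
        (∈-allFin k))

mainTheorem5 : (n : ℕ) (G : SimpleGraph n) → Connected G →
               (S : Vert G → Bool) → Stalled G S →
               card G S ≥ suc (2 * n) * SimpleGraph.m G + 2 →
               ∀ (k : Fin (SimpleGraph.m G)) (i : Fin (suc (2 * n))) → _∈S_ G (cp k i) S
mainTheorem5 n G _ S stalled big k i with S (cp k i) in i∉S
... | true  = refl
... | false = contradiction big (<⇒≱ (card-< G S stalled i∉S))
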